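{- Let $x,y,z,a,b$ be nodes (valid clusters) of a top tree satisfying the orientation invariant, with $z$ the parent of $y$ and $b$, and $y$ the parent of $x$ and $a$. If $y$ is a path cluster and $x$ hangs off to the same side as $y$, then $\mathrm{rotate\_up}(x)$ is allowed. Moreover, after performing $\mathrm{rotate\_up}(x)$ (with any adjustment of orientations satisfying the orientation invariant): (i) if $z$ is a path cluster and is not the root, then the node representing $a \cup b$ hangs off to the same side as $z$ after the rotation if and only if $b$ hung off to the same side as $z$ before the rotation; (ii) if $z$ is a point cluster, then $a \cup b$ is a point cluster after the rotation.
   Context: Let $F$ be a forest (the underlying forest) in which some vertices are marked as exposed. For a set $C$ of edges of $F$, a vertex $w$ is a boundary vertex of $C$ if $w$ is incident to an edge of $C$ and either $w$ is exposed or $w$ is incident to an edge of $F$ not in $C$. A cluster is a nonempty connected set of edges; it is valid if it has at most two boundary vertices; a valid cluster is a path cluster if it has exactly two boundary vertices and a point cluster if it has zero or one. A top tree for a tree $T$ of $F$ (with at least one edge) is a rooted tree in which every internal node has exactly two children and whose leaves are in bijection with the edges of $T$; each node is identified with the cluster consisting of the edges at the leaves of its subtree, and every such cluster is required to be connected and valid. The two children of an internal node share exactly one vertex, its central vertex. Orientation: each internal node has ordered children (left, right), each leaf has ordered endpoints (left, right). For a leaf, a boundary vertex is its left/right boundary vertex if it is its left/right endpoint; for an internal node, a boundary vertex is middle if it equals the central vertex, and otherwise left/right according to whether it is a boundary vertex of the left/right child. Leftmost boundary vertex: the left one if it exists, else the middle one if it exists, else none; rightmost symmetric. Orientation invariant: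 for every internal node, the rightmost boundary vertex of the left child and the leftmost boundary vertex of the right child exist and equal the central vertex. Two nodes hang off to the same side if both are left children or both are right children of their respective parents. Rotation: for a node $x$ with parent $y$ and grandparent $z$, let $a=\mathrm{sibling}(x)$ and $b=\mathrm{sibling}(y)$. The operation $\mathrm{rotate\_up}(x)$ is allowed iff $a\cup b$ is a valid cluster; it makes $a$ and $b$ the children of $y$ (so $y$ now represents $a\cup b$) and makes $x$ and $y$ the children of $z$, leaving all other parent–child relations unchanged, and then adjusts child orders and orientations (possibly reversing the orientation of whole subtrees, i.e. reversing child order at every internal node and endpoint order at every leaf of the subtree) in any way such that the orientation invariant holds. -}

module Defs where

open import Data.Nat using (ℕ; _≤_)
open import Data.Product using (Σ; ∃; _×_; _,_; proj₁; proj₂)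
open import Data.Sum using (_⊎_)
open import Data.Empty using (⊥)
open import Data.Unit using (⊤)
open import Data.Maybe using (Maybe; just; nothing)
open import Data.List using (List; []; _∷_; _++_; [_]; length)
open import Data.List.Relation.Unary.Any using (Any)
open import Data.List.Relation.Unary.All using (All)
open import Data.List.Relation.Unary.AllPairs using (AllPairs)
open import Data.List.Relation.Unary.Linked using (Linked)
open import Data.List.Relation.Unary.Unique.Propositional using (Unique)
open import Relation.Binary.PropositionalEquality using (_≡_; _≢_)
open import Relation.Binary.Construct.Closure.ReflexiveTransitive using (Star)
open import Relation.Nullary using (¬_)

-- Vertices are natural numbers; an edge is stored as an ordered pair of
-- endpoints, and edges are compared up to swapping the endpoints.
Vertex : Set
Vertex = ℕ

Edge : Set
Edge = Vertex × Vertex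

_≈e_ : Edge → Edge → Set
(u , v) ≈e (u' , v') = (u ≡ u' × v ≡ v') ⊎ (u ≡ v' × v ≡ u')

_∈ₑ_ : Edge → List Edge → Set
e ∈ₑ C = Any (λ e' → e ≈e e') C

Incident : Vertex → Edge → Set
Incident w (u , v) = (w ≡ u) ⊎ (w ≡ v)

Share : Edge → Edge → Set
Share e e' = ∃ λ w → Incident w e × Incident w e'

Adj : List Edge → Vertex → Vertex → Set
Adj E u v = (u , v) ∈ₑ E

Cycle : List Edge → Set
Cycle E = ∃ λ v → ∃ λ vs → 2 ≤ length vs × Unique (v ∷ vs)
          × Linked (Adj E) (v ∷ vs ++ [ v ])

record Forest : Set₁ where
  field
    edges   : List Edge
    exposed : Vertex → Set
    noLoop  : All (λ e → proj₁ e ≢ proj₂ e) edges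
    simple  : AllPairs (λ e e' → ¬ (e ≈e e')) edges
    acyclic : ¬ Cycle edges
open Forest public

NonEmpty : List Edge → Set
NonEmpty C = ∃ λ e → e ∈ₑ C

Step : List Edge → Edge → Edge → Set
Step C e e' = e ∈ₑ C × e' ∈ₑ C × Share e e'

Connected : List Edge → Set
Connected C = ∀ e e' → e ∈ₑ C → e' ∈ₑ C → Star (Step C) e e'

IsCluster : List Edge → Set
IsCluster C = NonEmpty C × Connected C

Boundary : Forest → List Edge → Vertex → Set
Boundary F C w = Any (Incident w) C
  × (exposed F w ⊎ (∃ λ e → e ∈ₑ edges F × Incident w e × ¬ (e ∈ₑ C)))

AtMostTwoBoundary : Forest → List Edge → Set
AtMostTwoBoundary F C = ∀ u v w → Boundary F C u → Boundary F C v → Boundary F C w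
  → u ≡ v ⊎ u ≡ w ⊎ v ≡ w

ValidCluster : Forest → List Edge → Set
ValidCluster F C = IsCluster C × AtMostTwoBoundary F C

PathCluster : Forest → List Edge → Set
PathCluster F C = ValidCluster F C
  × (∃ λ u → ∃ λ v → u ≢ v × Boundary F C u × Boundary F C v
       × (∀ w → Boundary F C w → w ≡ u ⊎ w ≡ v))

PointCluster : Forest → List Edge → Set
PointCluster F C = ValidCluster F C
  × (∀ u v → Boundary F C u → Boundary F C v → u ≡ v)

SameSet : List Edge → List Edge → Set
SameSet C D = ∀ e → (e ∈ₑ C → e ∈ₑ D) × (e ∈ₑ D → e ∈ₑ C)

-- leaf u v : a leaf for edge {u,v} with left endpoint u, right endpoint v
-- node l r : internal node with left child l and right child r
data Tree : Set where
  leaf : Vertex → Vertex → Tree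
  node : Tree → Tree → Tree

E : Tree → List Edge
E (leaf u v) = (u , v) ∷ []
E (node l r) = E l ++ E r

data Dir : Set where
  L R : Dir

mk : Dir → Tree → Tree → Tree
mk L c o = node c o
mk R c o = node o c

subtreeAt : Tree → List Dir → Maybe Tree
subtreeAt t [] = just t
subtreeAt (leaf _ _) (_ ∷ _) = nothing
subtreeAt (node l r) (L ∷ p) = subtreeAt l p
subtreeAt (node l r) (R ∷ p) = subtreeAt r p

replace : Tree → List Dir → Tree → Tree
replace t [] s = s
replace (leaf u v) (_ ∷ _) s = leaf u v
replace (node l r) (L ∷ p) s = node (replace l p s) r
replace (node l r) (R ∷ p) s = node l (replace r p s)

AllNodes : (Tree → Set) → Tree → Set
AllNodes P (leaf u v) = P (leaf u v)
AllNodes P (node l r) = P (node l r) × AllNodes P l × AllNodes P r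

-- t is a top tree for a tree T of F: the leaves are in bijection with the
-- edges of T (distinct edges of F forming a connected component of F),
-- and every node is a (connected) valid cluster.
TopTree : Forest → Tree → Set
TopTree F t = AllPairs (λ e e' → ¬ (e ≈e e')) (E t)
  × All (λ e → e ∈ₑ edges F) (E t)
  × (∀ e e' → e ∈ₑ edges F → e' ∈ₑ E t → Share e e' → e ∈ₑ E t)
  × AllNodes (λ s → ValidCluster F (E s)) t

Central : Tree → Tree → Vertex → Set
Central l r w = Any (Incident w) (E l) × Any (Incident w) (E r)

LeftB : Forest → Tree → Vertex → Set
LeftB F (leaf u v) w = Boundary F (E (leaf u v)) w × w ≡ u
LeftB F (node l r) w = Boundary F (E (node l r)) w × ¬ Central l r w × Boundary F (E l) w

RightB : Forest → Tree → Vertex → Set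
RightB F (leaf u v) w = Boundary F (E (leaf u v)) w × w ≡ v
RightB F (node l r) w = Boundary F (E (node l r)) w × ¬ Central l r w × Boundary F (E r) w

MiddleB : Forest → Tree → Vertex → Set
MiddleB F (leaf u v) w = ⊥
MiddleB F (node l r) w = Boundary F (E (node l r)) w × Central l r w

Leftmost : Forest → Tree → Vertex → Set
Leftmost F t w = LeftB F t w ⊎ ((∀ u → ¬ LeftB F t u) × MiddleB F t w)

Rightmost : Forest → Tree → Vertex → Set
Rightmost F t w = RightB F t w ⊎ ((∀ u → ¬ RightB F t u) × MiddleB F t w)

OrientInv : Forest → Tree → Set
OrientInv F (leaf u v) = ⊤
OrientInv F (node l r) =
  (∃ λ c → Central l r c × Rightmost F l c × Leftmost F r c)
  × OrientInv F l × OrientInv F r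

-- s is a reorientation of t: same unordered tree, with arbitrary child
-- orders and arbitrary endpoint orders
data _≅_ : Tree → Tree → Set where
  leaf-same : ∀ {u v} → leaf u v ≅ leaf u v
  leaf-flip : ∀ {u v} → leaf u v ≅ leaf v u
  node-same : ∀ {l r l' r'} → l ≅ l' → r ≅ r' → node l r ≅ node l' r'
  node-swap : ∀ {l r l' r'} → l ≅ r' → r ≅ l' → node l r ≅ node l' r'

-- some node of t representing cluster C is a s-child of its parent
SideOf : Tree → List Edge → Dir → Set
SideOf t C s = ∃ λ q → ∃ λ u → subtreeAt t (q ++ [ s ]) ≡ just u × SameSet (E u) C

SameSide : Tree → List Edge → List Edge → Set
SameSide t C D = ∃ λ s → SideOf t C s × SideOf t D s

-- Two disjoint connected edge sets of a forest share at most one vertex; everything below is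
-- counted with this fact. Since x hangs off to the same side as y, the central vertex cz of z is
-- the end of y pointing towards a, so the other boundary vertex w₁ of y lies in x, is not touched
-- by b, and is therefore a boundary vertex of z. A boundary vertex of a ∪ b is either the central
-- vertex cy of y or a boundary vertex of z different from w₁; as z has at most two boundary
-- vertices, one of them w₁, a ∪ b is valid, and a point cluster when z is.
-- For (i), the central vertex c of z's parent is the only vertex z shares with its sibling, so it
-- is the same before and after the rotation, and it is the end of z facing the sibling. The same
-- counting shows that c is the end of z on y's side (away from b) exactly when it is the end of
-- z on x's side (away from a ∪ b), so b and a ∪ b sit on the same side before and after.
module Submission where

open import Defs
open import Data.Nat using (_≤_; z≤n; s≤s)
open import Data.Nat.Properties using (_≟_)
open import Data.Product using (∃; _×_; _,_; proj₁; proj₂)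
open import Data.Sum using (_⊎_; inj₁; inj₂)
import Data.Sum as Sum
open import Data.Empty using (⊥; ⊥-elim)
open import Data.Unit using (⊤; tt)
open import Data.Maybe using (just)
open import Data.List using (List; []; _∷_; _++_; [_]; length; initLast; _∷ʳ′_)
open import Data.List.Properties using (∷ʳ-injectiveʳ; ++-assoc)
open import Data.List.Relation.Unary.Any using (Any; here; there; any?)
import Data.List.Relation.Unary.Any.Properties as Anyₚ
open import Data.List.Relation.Unary.All using (All; []; _∷_)
import Data.List.Relation.Unary.All as All
import Data.List.Relation.Unary.All.Properties as Allₚ
open import Data.List.Relation.Unary.AllPairs using (AllPairs; []; _∷_)
open import Data.List.Relation.Unary.Linked using (Linked; [-]; _∷_)
open import Data.List.Membership.Propositional using (_∈_; find)
open import Data.List.Membership.DecPropositional _≟_ using (_∈?_)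
open import Relation.Binary.PropositionalEquality using (_≡_; _≢_; refl; sym; trans; cong; subst)
open import Relation.Binary.Construct.Closure.ReflexiveTransitive using (Star; ε; _◅_; _◅◅_)
import Relation.Binary.Construct.Closure.ReflexiveTransitive as Star
open import Relation.Nullary using (¬_; Dec; yes; no)
open import Function.Bundles using (_⇔_; mk⇔)
import Function.Properties.Equivalence as ⇔

≈e-refl : ∀ {e} → e ≈e e
≈e-refl = inj₁ (refl , refl)

≈e-sym : ∀ {e e'} → e ≈e e' → e' ≈e e
≈e-sym (inj₁ (refl , refl)) = inj₁ (refl , refl)
≈e-sym (inj₂ (refl , refl)) = inj₂ (refl , refl)

≈e-trans : ∀ {e e' e''} → e ≈e e' → e' ≈e e'' → e ≈e e''
≈e-trans (inj₁ (refl , refl)) q = q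
≈e-trans (inj₂ (refl , refl)) (inj₁ (refl , refl)) = inj₂ (refl , refl)
≈e-trans (inj₂ (refl , refl)) (inj₂ (refl , refl)) = inj₁ (refl , refl)

≈e-swap : ∀ {u v} → (u , v) ≈e (v , u)
≈e-swap = inj₂ (refl , refl)

_≈e?_ : (e e' : Edge) → Dec (e ≈e e')
(u , v) ≈e? (u' , v') with u ≟ u' | v ≟ v' | u ≟ v' | v ≟ u'
... | yes p | yes q | _     | _     = yes (inj₁ (p , q))
... | _     | _     | yes p | yes q = yes (inj₂ (p , q))
... | no p  | _     | no r  | _     = no λ { (inj₁ (a , _)) → p a ; (inj₂ (a , _)) → r a }
... | no p  | _     | yes _ | no s  = no λ { (inj₁ (a , _)) → p a ; (inj₂ (_ , b)) → s b }
... | yes _ | no q  | no r  | _     = no λ { (inj₁ (_ , b)) → q b ; (inj₂ (a , _)) → r a }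
... | yes _ | no q  | yes _ | no s  = no λ { (inj₁ (_ , b)) → q b ; (inj₂ (_ , b)) → s b }

_∈ₑ?_ : (e : Edge) (C : List Edge) → Dec (e ∈ₑ C)
e ∈ₑ? C = any? (e ≈e?_) C

∈ₑ-resp-≈e : ∀ {e e' C} → e ≈e e' → e' ∈ₑ C → e ∈ₑ C
∈ₑ-resp-≈e p (here q)  = here (≈e-trans p q)
∈ₑ-resp-≈e p (there q) = there (∈ₑ-resp-≈e p q)

Incident-resp-≈e : ∀ {w e e'} → Incident w e → e ≈e e' → Incident w e'
Incident-resp-≈e (inj₁ refl) (inj₁ (refl , refl)) = inj₁ refl
Incident-resp-≈e (inj₂ refl) (inj₁ (refl , refl)) = inj₂ refl
Incident-resp-≈e (inj₁ refl) (inj₂ (refl , refl)) = inj₂ refl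
Incident-resp-≈e (inj₂ refl) (inj₂ (refl , refl)) = inj₁ refl

incident? : (w : Vertex) (e : Edge) → Dec (Incident w e)
incident? w (u , v) with w ≟ u | w ≟ v
... | yes p | _     = yes (inj₁ p)
... | no _  | yes q = yes (inj₂ q)
... | no p  | no q  = no λ { (inj₁ a) → p a ; (inj₂ b) → q b }

Touches : List Edge → Vertex → Set
Touches C w = Any (Incident w) C

touches? : (C : List Edge) (w : Vertex) → Dec (Touches C w)
touches? C w = any? (incident? w) C

Touches⇒edge : ∀ {w C} → Touches C w → ∃ λ e → e ∈ₑ C × Incident w e
Touches⇒edge (here p) = _ , here ≈e-refl , p
Touches⇒edge (there p) with Touches⇒edge p
... | e , e∈C , w∈e = e , there e∈C , w∈e

edge⇒Touches : ∀ {w e C} → e ∈ₑ C → Incident w e → Touches C w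
edge⇒Touches (here q)  i = here (Incident-resp-≈e i q)
edge⇒Touches (there m) i = there (edge⇒Touches m i)

_⊆ₑ_ : List Edge → List Edge → Set
C ⊆ₑ D = ∀ e → e ∈ₑ C → e ∈ₑ D

Disjointₑ : List Edge → List Edge → Set
Disjointₑ C D = ∀ e → e ∈ₑ C → e ∈ₑ D → ⊥

⊆ₑ-trans : ∀ {C D G} → C ⊆ₑ D → D ⊆ₑ G → C ⊆ₑ G
⊆ₑ-trans C⊆D D⊆G e m = D⊆G e (C⊆D e m)

⊆ₑ-++ˡ : ∀ {C D} → C ⊆ₑ (C ++ D)
⊆ₑ-++ˡ e m = Anyₚ.++⁺ˡ m

⊆ₑ-++ʳ : ∀ {C D} → D ⊆ₑ (C ++ D)
⊆ₑ-++ʳ {C} e m = Anyₚ.++⁺ʳ C m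

∈ₑ-++⁻ : ∀ {C D e} → e ∈ₑ (C ++ D) → e ∈ₑ C ⊎ e ∈ₑ D
∈ₑ-++⁻ {C} = Anyₚ.++⁻ C

Touches-++⁻ : ∀ {C D w} → Touches (C ++ D) w → Touches C w ⊎ Touches D w
Touches-++⁻ {C} = Anyₚ.++⁻ C

Touches-⊆ₑ : ∀ {C D w} → C ⊆ₑ D → Touches C w → Touches D w
Touches-⊆ₑ C⊆D t with Touches⇒edge t
... | e , e∈C , w∈e = edge⇒Touches (C⊆D e e∈C) w∈e

Disjointₑ-sym : ∀ {C D} → Disjointₑ C D → Disjointₑ D C
Disjointₑ-sym C#D e d c = C#D e c d

All⇒⊆ₑ : ∀ {G C} → All (λ e → e ∈ₑ G) C → C ⊆ₑ G
All⇒⊆ₑ all e m with find m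
... | e' , e'∈C , e≈e' = ∈ₑ-resp-≈e e≈e' (All.lookup all e'∈C)

SameSet-refl : ∀ {C} → SameSet C C
SameSet-refl e = (λ m → m) , (λ m → m)

SameSet-sym : ∀ {C D} → SameSet C D → SameSet D C
SameSet-sym C≈D e = proj₂ (C≈D e) , proj₁ (C≈D e)

SameSet-trans : ∀ {C D G} → SameSet C D → SameSet D G → SameSet C G
SameSet-trans C≈D D≈G e =
  (λ m → proj₁ (D≈G e) (proj₁ (C≈D e) m)) , (λ m → proj₂ (C≈D e) (proj₂ (D≈G e) m))

SameSet⇒⊆ₑ : ∀ {C D} → SameSet C D → C ⊆ₑ D
SameSet⇒⊆ₑ C≈D e = proj₁ (C≈D e)

++-⊆ₑ : ∀ {C C' D D'} → C ⊆ₑ C' → D ⊆ₑ D' → (C ++ D) ⊆ₑ (C' ++ D')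
++-⊆ₑ {C} {C'} C⊆ D⊆ e m with ∈ₑ-++⁻ {C} m
... | inj₁ c = ⊆ₑ-++ˡ e (C⊆ e c)
... | inj₂ d = ⊆ₑ-++ʳ {C'} e (D⊆ e d)

++-SameSet : ∀ {C C' D D'} → SameSet C C' → SameSet D D' → SameSet (C ++ D) (C' ++ D')
++-SameSet C≈ D≈ e =
  ++-⊆ₑ (SameSet⇒⊆ₑ C≈) (SameSet⇒⊆ₑ D≈) e ,
  ++-⊆ₑ (SameSet⇒⊆ₑ (SameSet-sym C≈)) (SameSet⇒⊆ₑ (SameSet-sym D≈)) e

++-⊆ₑ-comm : ∀ {C D} → (C ++ D) ⊆ₑ (D ++ C)
++-⊆ₑ-comm {C} {D} e m with ∈ₑ-++⁻ {C} m
... | inj₁ c = ⊆ₑ-++ʳ {D} e c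
... | inj₂ d = ⊆ₑ-++ˡ e d

++-SameSet-comm : ∀ {C D} → SameSet (C ++ D) (D ++ C)
++-SameSet-comm {C} {D} e = ++-⊆ₑ-comm {C} e , ++-⊆ₑ-comm {D} e

Disjointₑ-SameSet : ∀ {C C' D D'} → SameSet C C' → SameSet D D' → Disjointₑ C D → Disjointₑ C' D'
Disjointₑ-SameSet C≈ D≈ C#D e c d = C#D e (proj₂ (C≈ e) c) (proj₂ (D≈ e) d)

edge⇒walk : ∀ {G u v e} → e ∈ₑ G → Incident u e → Incident v e → Star (Adj G) u v
edge⇒walk m (inj₁ refl) (inj₁ refl) = ε
edge⇒walk m (inj₂ refl) (inj₂ refl) = ε
edge⇒walk m (inj₁ refl) (inj₂ refl) = m ◅ ε
edge⇒walk m (inj₂ refl) (inj₁ refl) = ∈ₑ-resp-≈e ≈e-swap m ◅ ε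

steps⇒walk : ∀ {G u v e e'} → e ∈ₑ G → Star (Step G) e e' → Incident u e → Incident v e'
  → Star (Adj G) u v
steps⇒walk m ε iu iv = edge⇒walk m iu iv
steps⇒walk m ((m₁ , m₂ , w , i₁ , i₂) ◅ rest) iu iv =
  edge⇒walk m₁ iu i₁ ◅◅ steps⇒walk m₂ rest i₂ iv

Connected⇒walk : ∀ {G u v} → Connected G → Touches G u → Touches G v → Star (Adj G) u v
Connected⇒walk conn tu tv with Touches⇒edge tu | Touches⇒edge tv
... | e , m , i | e' , m' , i' = steps⇒walk m (conn e e' m m') i i'

data SimplePath (R : Vertex → Vertex → Set) : Vertex → Vertex → List Vertex → Set where
  stop : ∀ {v} → SimplePath R v v (v ∷ [])
  step : ∀ {u w v vs} → R u w → SimplePath R w v vs → ¬ (u ∈ vs) → SimplePath R u v (u ∷ vs)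

SimplePath-suffix : ∀ {R u w v vs} → SimplePath R w v vs → u ∈ vs → ∃ λ vs' → SimplePath R u v vs'
SimplePath-suffix stop (here refl) = _ , stop
SimplePath-suffix (step r sp n) (here refl) = _ , step r sp n
SimplePath-suffix (step r sp n) (there m) = SimplePath-suffix sp m

Star⇒SimplePath : ∀ {R u v} → Star R u v → ∃ λ vs → SimplePath R u v vs
Star⇒SimplePath ε = _ , stop
Star⇒SimplePath {u = u} (r ◅ rest) with Star⇒SimplePath rest
... | vs , sp with u ∈? vs
...   | yes u∈vs = SimplePath-suffix sp u∈vs
...   | no  u∉vs = _ , step r sp u∉vs

SimplePath-start∈ : ∀ {R u v vs} → SimplePath R u v vs → u ∈ vs
SimplePath-start∈ stop = here refl
SimplePath-start∈ (step _ _ _) = here refl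

SimplePath⇒Star : ∀ {R R' : Vertex → Vertex → Set} {u v vs} → SimplePath R u v vs
  → (∀ {x y} → x ∈ vs → y ∈ vs → R x y → R' x y) → Star R' u v
SimplePath⇒Star stop f = ε
SimplePath⇒Star (step r sp n) f =
  f (here refl) (there (SimplePath-start∈ sp)) r ◅ SimplePath⇒Star sp (λ a b → f (there a) (there b))

SimplePath-distinct : ∀ {R u v vs} → SimplePath R u v vs → AllPairs _≢_ vs
SimplePath-distinct stop = [] ∷ []
SimplePath-distinct (step r sp n) = Allₚ.¬Any⇒All¬ _ n ∷ SimplePath-distinct sp

SimplePath-linked : ∀ {R R' : Vertex → Vertex → Set} {u v x vs} → SimplePath R u v vs
  → (∀ {a b} → R a b → R' a b) → R' v x → Linked R' (vs ++ [ x ])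
SimplePath-linked stop f r = r ∷ [-]
SimplePath-linked (step r stop n) f r' = f r ∷ (r' ∷ [-])
SimplePath-linked (step r (step r₂ sp n₂) n) f r' = f r ∷ SimplePath-linked (step r₂ sp n₂) f r'

AdjAvoiding : List Edge → Vertex → Vertex → Vertex → Vertex → Set
AdjAvoiding G u v a b = Adj G a b × ¬ ((a , b) ≈e (u , v))

detour⇒Cycle : ∀ {G u v vs} → (u , v) ∈ₑ G → u ≢ v → SimplePath (AdjAvoiding G u v) v u vs → Cycle G
detour⇒Cycle m u≢v stop = ⊥-elim (u≢v refl)
detour⇒Cycle m u≢v (step (_ , avoid) stop _) = ⊥-elim (avoid ≈e-swap)
detour⇒Cycle {G} {u} {v} m u≢v path@(step _ (step {w₂} {vs = vs₂} _ sp _) _) =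
  v , (w₂ ∷ vs₂) , two≤ sp , SimplePath-distinct path , SimplePath-linked path proj₁ m
  where
  two≤ : ∀ {R a b xs} → SimplePath R a b xs → 2 ≤ length (w₂ ∷ xs)
  two≤ stop = s≤s (s≤s z≤n)
  two≤ (step _ _ _) = s≤s (s≤s z≤n)

edges-noLoop : (F : Forest) → ∀ {u v} → (u , v) ∈ₑ edges F → u ≢ v
edges-noLoop F = go (noLoop F)
  where
  go : ∀ {C u v} → All (λ e → proj₁ e ≢ proj₂ e) C → (u , v) ∈ₑ C → u ≢ v
  go (u≢v ∷ _) (here (inj₁ (refl , refl))) = u≢v
  go (u≢v ∷ _) (here (inj₂ (refl , refl))) = λ e → u≢v (sym e)
  go (_ ∷ all) (there m) = go all m

-- A second shared vertex would close a cycle: leave u along the first edge of a simple path to v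
-- inside X, and come back from v to u inside Y, which avoids that edge.
shared-vertex-unique : (F : Forest) {X Y : List Edge} {u v : Vertex}
  → Connected X → Connected Y → X ⊆ₑ edges F → Y ⊆ₑ edges F → Disjointₑ X Y
  → Touches X u → Touches Y u → Touches X v → Touches Y v → u ≡ v
shared-vertex-unique F {X} {Y} {u} {v} X-conn Y-conn X⊆F Y⊆F X#Y xu yu xv yv with u ≟ v
... | yes u≡v = u≡v
... | no _ with Star⇒SimplePath (Connected⇒walk X-conn xu xv)
...   | _ , stop = refl
...   | _ , step {w = u₁} r sp u∉sp =
  ⊥-elim (acyclic F (detour⇒Cycle (X⊆F _ r) (edges-noLoop F (X⊆F _ r))
                                 (proj₂ (Star⇒SimplePath back))))
  where
  back : Star (AdjAvoiding (edges F) u u₁) u₁ u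
  back = SimplePath⇒Star sp (λ x∈ y∈ a → X⊆F _ a ,
                              λ { (inj₁ (refl , _)) → u∉sp x∈ ; (inj₂ (_ , refl)) → u∉sp y∈ })
         ◅◅ Star.map (λ a → Y⊆F _ a , λ q → X#Y _ r (∈ₑ-resp-≈e (≈e-sym q) a))
                     (Connected⇒walk Y-conn yv yu)

Boundary-⊆ₑ : ∀ {F C D w} → C ⊆ₑ D → Touches C w → Boundary F D w → Boundary F C w
Boundary-⊆ₑ C⊆D t (_ , inj₁ ex) = t , inj₁ ex
Boundary-⊆ₑ C⊆D t (_ , inj₂ (e , e∈F , w∈e , e∉D)) =
  t , inj₂ (e , e∈F , w∈e , λ e∈C → e∉D (C⊆D e e∈C))

Boundary-SameSet : ∀ {F C D w} → SameSet C D → Boundary F C w → Boundary F D w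
Boundary-SameSet {F} C≈D b =
  Boundary-⊆ₑ {F} (SameSet⇒⊆ₑ (SameSet-sym C≈D)) (Touches-⊆ₑ (SameSet⇒⊆ₑ C≈D) (proj₁ b)) b

Star-Step-⊆ₑ : ∀ {C D e e'} → C ⊆ₑ D → Star (Step C) e e' → Star (Step D) e e'
Star-Step-⊆ₑ C⊆D = Star.map λ { (m , m' , sh) → C⊆D _ m , C⊆D _ m' , sh }

Connected-++ : ∀ {C D w} → Connected C → Connected D → Touches C w → Touches D w → Connected (C ++ D)
Connected-++ {C} {D} {w} C-conn D-conn tC tD e e' m m'
  with Touches⇒edge tC | Touches⇒edge tD | ∈ₑ-++⁻ {C} m | ∈ₑ-++⁻ {C} m'
... | _ | _ | inj₁ c | inj₁ c' = Star-Step-⊆ₑ ⊆ₑ-++ˡ (C-conn _ _ c c')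
... | _ | _ | inj₂ d | inj₂ d' = Star-Step-⊆ₑ (⊆ₑ-++ʳ {C}) (D-conn _ _ d d')
... | eC , mC , iC | eD , mD , iD | inj₁ c | inj₂ d =
  Star-Step-⊆ₑ ⊆ₑ-++ˡ (C-conn _ _ c mC) ◅◅
  ((⊆ₑ-++ˡ _ mC , ⊆ₑ-++ʳ {C} _ mD , w , iC , iD) ◅ Star-Step-⊆ₑ (⊆ₑ-++ʳ {C}) (D-conn _ _ mD d))
... | eC , mC , iC | eD , mD , iD | inj₂ d | inj₁ c =
  Star-Step-⊆ₑ (⊆ₑ-++ʳ {C}) (D-conn _ _ d mD) ◅◅
  ((⊆ₑ-++ʳ {C} _ mD , ⊆ₑ-++ˡ _ mC , w , iD , iC) ◅ Star-Step-⊆ₑ ⊆ₑ-++ˡ (C-conn _ _ mC c))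

PathCluster-other-end : ∀ {F C c} → PathCluster F C → Boundary F C c
  → ∃ λ w → Boundary F C w × w ≢ c × (∀ v → Boundary F C v → v ≡ w ⊎ v ≡ c)
PathCluster-other-end {c = c} (_ , u , v , u≢v , bu , bv , only) bc with c ≟ u
... | yes refl = v , bv , (λ e → u≢v (sym e)) , λ w b → Sum.swap (only w b)
... | no c≢u = u , bu , (λ e → c≢u (sym e)) , λ w b → to-c (only w b) (only c bc)
  where
  to-c : ∀ {w} → w ≡ u ⊎ w ≡ v → c ≡ u ⊎ c ≡ v → w ≡ u ⊎ w ≡ c
  to-c (inj₁ e) _ = inj₁ e
  to-c (inj₂ e) (inj₁ e') = ⊥-elim (c≢u e')
  to-c (inj₂ e) (inj₂ e') = inj₂ (trans e (sym e'))

PathCluster-avoid : ∀ {F C} → PathCluster F C → ∀ c → ∃ λ o → Boundary F C o × o ≢ c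
PathCluster-avoid (_ , u , v , u≢v , bu , bv , _) c with c ≟ u
... | yes refl = v , bv , λ e → u≢v (sym e)
... | no c≢u = u , bu , λ e → c≢u (sym e)

-- End F Z P Q w, for Z split into P and Q, is Leftmost F (node P Q) w stated for edge sets:
-- w is the end of Z on the side of P.
End : Forest → List Edge → List Edge → List Edge → Vertex → Set
End F Z P Q w =
  (Boundary F Z w × ¬ (Touches P w × Touches Q w) × Boundary F P w)
  ⊎ ((∀ u → ¬ (Boundary F Z u × ¬ (Touches P u × Touches Q u) × Boundary F P u))
     × Boundary F Z w × Touches P w × Touches Q w)

End⇒Boundary : ∀ {F Z P Q w} → End F Z P Q w → Boundary F Z w
End⇒Boundary (inj₁ (b , _)) = b
End⇒Boundary (inj₂ (_ , b , _)) = b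

End⇒Touches : ∀ {F Z P Q w} → End F Z P Q w → Touches P w
End⇒Touches (inj₁ (_ , _ , b)) = proj₁ b
End⇒Touches (inj₂ (_ , _ , t , _)) = t

End-SameSet : ∀ {F Z Z' P P' Q Q' w} → SameSet Z Z' → SameSet P P' → SameSet Q Q'
  → End F Z P Q w → End F Z' P' Q' w
End-SameSet {F} Z≈ P≈ Q≈ (inj₁ (bZ , notBoth , bP)) =
  inj₁ (Boundary-SameSet {F} Z≈ bZ ,
        (λ { (p , q) → notBoth (Touches-⊆ₑ (SameSet⇒⊆ₑ (SameSet-sym P≈)) p ,
                                Touches-⊆ₑ (SameSet⇒⊆ₑ (SameSet-sym Q≈)) q) }) ,
        Boundary-SameSet {F} P≈ bP)
End-SameSet {F} Z≈ P≈ Q≈ (inj₂ (none , bZ , tP , tQ)) =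
  inj₂ ((λ u → λ { (bZ' , notBoth , bP') →
           none u (Boundary-SameSet {F} (SameSet-sym Z≈) bZ' ,
                   (λ { (p , q) → notBoth (Touches-⊆ₑ (SameSet⇒⊆ₑ P≈) p ,
                                           Touches-⊆ₑ (SameSet⇒⊆ₑ Q≈) q) }) ,
                   Boundary-SameSet {F} (SameSet-sym P≈) bP') }) ,
        Boundary-SameSet {F} Z≈ bZ , Touches-⊆ₑ (SameSet⇒⊆ₑ P≈) tP , Touches-⊆ₑ (SameSet⇒⊆ₑ Q≈) tQ)

Leftmost⇒End : ∀ {F l r c} → Leftmost F (node l r) c → End F (E l ++ E r) (E l) (E r) c
Leftmost⇒End end = end

Rightmost⇒End : ∀ {F l r c} → Rightmost F (node l r) c → End F (E l ++ E r) (E r) (E l) c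
Rightmost⇒End (inj₁ (b , notCentral , br)) = inj₁ (b , (λ { (r , l) → notCentral (l , r) }) , br)
Rightmost⇒End (inj₂ (none , b , tl , tr)) =
  inj₂ ((λ u → λ { (bz , notBoth , bp) → none u (bz , (λ { (l , r) → notBoth (r , l) }) , bp) }) ,
        b , tr , tl)

module RotationClusters (F : Forest) (X A B Y Z : List Edge)
  (Y≈X∪A : SameSet Y (X ++ A)) (Z≈Y∪B : SameSet Z (Y ++ B))
  (X-conn : Connected X) (A-conn : Connected A) (B-conn : Connected B) (Y-conn : Connected Y)
  (Z⊆F : Z ⊆ₑ edges F) (X#A : Disjointₑ X A) (X#B : Disjointₑ X B) (A#B : Disjointₑ A B)
  (Y-path : PathCluster F Y) (A-valid : AtMostTwoBoundary F A) (Z-valid : AtMostTwoBoundary F Z)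
  (cy : Vertex) (cy∈X : Touches X cy) (cy∈A : Touches A cy)
  (cz : Vertex) (cz∈B : Touches B cz) (cz-end : End F Y A X cz)
  where

  AB : List Edge
  AB = A ++ B

  Y⊆Z : Y ⊆ₑ Z
  Y⊆Z e m = proj₂ (Z≈Y∪B e) (⊆ₑ-++ˡ e m)

  B⊆Z : B ⊆ₑ Z
  B⊆Z e m = proj₂ (Z≈Y∪B e) (⊆ₑ-++ʳ {Y} e m)

  X⊆Y : X ⊆ₑ Y
  X⊆Y e m = proj₂ (Y≈X∪A e) (⊆ₑ-++ˡ e m)

  A⊆Y : A ⊆ₑ Y
  A⊆Y e m = proj₂ (Y≈X∪A e) (⊆ₑ-++ʳ {X} e m)

  X⊆Z : X ⊆ₑ Z
  X⊆Z = ⊆ₑ-trans X⊆Y Y⊆Z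

  AB⊆Z : AB ⊆ₑ Z
  AB⊆Z e m with ∈ₑ-++⁻ {A} m
  ... | inj₁ a = ⊆ₑ-trans A⊆Y Y⊆Z e a
  ... | inj₂ b = B⊆Z e b

  ∈ₑZ⁻ : ∀ {e} → e ∈ₑ Z → e ∈ₑ X ⊎ e ∈ₑ A ⊎ e ∈ₑ B
  ∈ₑZ⁻ m with ∈ₑ-++⁻ {Y} (proj₁ (Z≈Y∪B _) m)
  ... | inj₂ b = inj₂ (inj₂ b)
  ... | inj₁ y with ∈ₑ-++⁻ {X} (proj₁ (Y≈X∪A _) y)
  ...   | inj₁ x = inj₁ x
  ...   | inj₂ a = inj₂ (inj₁ a)

  TouchesZ⁻ : ∀ {w} → Touches Z w → Touches X w ⊎ Touches A w ⊎ Touches B w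
  TouchesZ⁻ t with Touches⇒edge t
  ... | e , m , i = Sum.map (λ x → edge⇒Touches x i) (Sum.map (λ a → edge⇒Touches a i)
                                                              (λ b → edge⇒Touches b i)) (∈ₑZ⁻ m)

  TouchesAB-A : ∀ {w} → Touches A w → Touches AB w
  TouchesAB-A = Touches-⊆ₑ ⊆ₑ-++ˡ

  TouchesAB-B : ∀ {w} → Touches B w → Touches AB w
  TouchesAB-B = Touches-⊆ₑ (⊆ₑ-++ʳ {A})

  cz∈A : Touches A cz
  cz∈A = End⇒Touches {F} cz-end

  AB-conn : Connected AB
  AB-conn = Connected-++ A-conn B-conn cz∈A cz∈B

  X#AB : Disjointₑ X AB
  X#AB e x m with ∈ₑ-++⁻ {A} m
  ... | inj₁ a = X#A e x a
  ... | inj₂ b = X#B e x b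

  Y#B : Disjointₑ Y B
  Y#B e y b with ∈ₑ-++⁻ {X} (proj₁ (Y≈X∪A e) y)
  ... | inj₁ x = X#B e x b
  ... | inj₂ a = A#B e a b

  shared-X-AB : ∀ {u v} → Touches X u → Touches AB u → Touches X v → Touches AB v → u ≡ v
  shared-X-AB = shared-vertex-unique F X-conn AB-conn (⊆ₑ-trans X⊆Z Z⊆F) (⊆ₑ-trans AB⊆Z Z⊆F) X#AB

  shared-A-B : ∀ {u v} → Touches A u → Touches B u → Touches A v → Touches B v → u ≡ v
  shared-A-B = shared-vertex-unique F A-conn B-conn (⊆ₑ-trans (⊆ₑ-trans A⊆Y Y⊆Z) Z⊆F)
                                   (⊆ₑ-trans B⊆Z Z⊆F) A#B

  shared-Y-B : ∀ {u v} → Touches Y u → Touches B u → Touches Y v → Touches B v → u ≡ v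
  shared-Y-B = shared-vertex-unique F Y-conn B-conn (⊆ₑ-trans Y⊆Z Z⊆F) (⊆ₑ-trans B⊆Z Z⊆F) Y#B

  ≡cy : ∀ {w} → Touches X w → Touches AB w → w ≡ cy
  ≡cy x ab = shared-X-AB x ab cy∈X (TouchesAB-A cy∈A)

  y-other-end : ∃ λ w → Boundary F Y w × w ≢ cz × (∀ v → Boundary F Y v → v ≡ w ⊎ v ≡ cz)
  y-other-end = PathCluster-other-end {F} Y-path (End⇒Boundary {F} cz-end)

  w₁ : Vertex
  w₁ = proj₁ y-other-end

  w₁-Boundary-Y : Boundary F Y w₁
  w₁-Boundary-Y = proj₁ (proj₂ y-other-end)

  w₁≢cz : w₁ ≢ cz
  w₁≢cz = proj₁ (proj₂ (proj₂ y-other-end))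

  Boundary-Y⁻ : ∀ w → Boundary F Y w → w ≡ w₁ ⊎ w ≡ cz
  Boundary-Y⁻ = proj₂ (proj₂ (proj₂ y-other-end))

  cy-Boundary-A : Boundary F A cy
  cy-Boundary-A with Touches⇒edge cy∈X
  ... | e , m , i = cy∈A , inj₂ (e , Z⊆F e (X⊆Z e m) , i , X#A e m)

  -- If w₁ were in a but not in x, it would be a third boundary vertex of a besides cy and cz.
  w₁∈X : Touches X w₁
  w₁∈X = from-end cz-end
    where
    w₁-Boundary-A : Touches A w₁ → Boundary F A w₁
    w₁-Boundary-A a = Boundary-⊆ₑ {F} A⊆Y a w₁-Boundary-Y
    from-end : End F Y A X cz → Touches X w₁
    from-end end with Touches-++⁻ {X} (Touches-⊆ₑ (SameSet⇒⊆ₑ Y≈X∪A) (proj₁ w₁-Boundary-Y))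
    ... | inj₁ x = x
    ... | inj₂ a with touches? X w₁ | end
    ...   | yes x | _ = x
    ...   | no w₁∉X | inj₂ (none , _) =
      ⊥-elim (none w₁ (w₁-Boundary-Y , (λ p → w₁∉X (proj₂ p)) , w₁-Boundary-A a))
    ...   | no w₁∉X | inj₁ (_ , notBoth , cz-Boundary-A)
      with A-valid cy w₁ cz cy-Boundary-A (w₁-Boundary-A a) cz-Boundary-A
    ...     | inj₁ e = subst (Touches X) e cy∈X
    ...     | inj₂ (inj₁ e) = ⊥-elim (notBoth (subst (Touches A) e cy∈A , subst (Touches X) e cy∈X))
    ...     | inj₂ (inj₂ e) = ⊥-elim (w₁≢cz e)

  w₁∉B : ¬ Touches B w₁
  w₁∉B w₁∈B = w₁≢cz (trans w₁≡cy (shared-A-B cy∈A (subst (Touches B) w₁≡cy w₁∈B) cz∈A cz∈B))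
    where
    w₁≡cy : w₁ ≡ cy
    w₁≡cy = ≡cy w₁∈X (TouchesAB-B w₁∈B)

  w₁-Boundary-Z : Boundary F Z w₁
  w₁-Boundary-Z with w₁-Boundary-Y
  ... | t , inj₁ ex = Touches-⊆ₑ Y⊆Z t , inj₁ ex
  ... | t , inj₂ (e , e∈F , i , e∉Y) with e ∈ₑ? Z
  ...   | no e∉Z = Touches-⊆ₑ Y⊆Z t , inj₂ (e , e∈F , i , e∉Z)
  ...   | yes e∈Z with ∈ₑ-++⁻ {Y} (proj₁ (Z≈Y∪B e) e∈Z)
  ...     | inj₁ y = ⊥-elim (e∉Y y)
  ...     | inj₂ b = ⊥-elim (w₁∉B (edge⇒Touches b i))

  Boundary-AB⁻ : ∀ {w} → Boundary F AB w → w ≡ cy ⊎ (Boundary F Z w × w ≢ w₁)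
  Boundary-AB⁻ {w} b with w ≟ cy
  ... | yes w≡cy = inj₁ w≡cy
  ... | no w≢cy = inj₂ (Boundary-Z b , λ e → w≢cy (≡cy (subst (Touches X) (sym e) w₁∈X) (proj₁ b)))
    where
    Boundary-Z : Boundary F AB w → Boundary F Z w
    Boundary-Z (t , inj₁ ex) = Touches-⊆ₑ AB⊆Z t , inj₁ ex
    Boundary-Z (t , inj₂ (e , e∈F , i , e∉AB)) with e ∈ₑ? Z
    ... | no e∉Z = Touches-⊆ₑ AB⊆Z t , inj₂ (e , e∈F , i , e∉Z)
    ... | yes e∈Z with ∈ₑZ⁻ e∈Z
    ...   | inj₁ x = ⊥-elim (w≢cy (≡cy (edge⇒Touches x i) t))
    ...   | inj₂ (inj₁ a) = ⊥-elim (e∉AB (⊆ₑ-++ˡ e a))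
    ...   | inj₂ (inj₂ b) = ⊥-elim (e∉AB (⊆ₑ-++ʳ {A} e b))

  Boundary-Z-≢w₁-unique : ∀ {u v} → Boundary F Z u → u ≢ w₁ → Boundary F Z v → v ≢ w₁ → u ≡ v
  Boundary-Z-≢w₁-unique bu u≢w₁ bv v≢w₁ with Z-valid _ _ _ bu bv w₁-Boundary-Z
  ... | inj₁ e = e
  ... | inj₂ (inj₁ e) = ⊥-elim (u≢w₁ e)
  ... | inj₂ (inj₂ e) = ⊥-elim (v≢w₁ e)

  AB-valid : ValidCluster F AB
  AB-valid = ((_ , proj₁ (proj₂ (Touches⇒edge (TouchesAB-A cy∈A)))) , AB-conn) , atMostTwo
    where
    atMostTwo : AtMostTwoBoundary F AB
    atMostTwo u v w bu bv bw with Boundary-AB⁻ bu | Boundary-AB⁻ bv | Boundary-AB⁻ bw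
    ... | inj₁ p | inj₁ q | _ = inj₁ (trans p (sym q))
    ... | inj₁ p | _ | inj₁ r = inj₂ (inj₁ (trans p (sym r)))
    ... | _ | inj₁ q | inj₁ r = inj₂ (inj₂ (trans q (sym r)))
    ... | inj₂ (p , p') | inj₂ (q , q') | _ = inj₁ (Boundary-Z-≢w₁-unique p p' q q')
    ... | inj₂ (p , p') | _ | inj₂ (r , r') = inj₂ (inj₁ (Boundary-Z-≢w₁-unique p p' r r'))
    ... | _ | inj₂ (q , q') | inj₂ (r , r') = inj₂ (inj₂ (Boundary-Z-≢w₁-unique q q' r r'))

  AB-point : PointCluster F Z → PointCluster F AB
  AB-point (_ , Z-one) = AB-valid , λ u v bu bv → both-cy (Boundary-AB⁻ bu) (Boundary-AB⁻ bv)
    where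
    both-cy : ∀ {u v} → u ≡ cy ⊎ (Boundary F Z u × u ≢ w₁) → v ≡ cy ⊎ (Boundary F Z v × v ≢ w₁)
      → u ≡ v
    both-cy (inj₁ p) (inj₁ q) = trans p (sym q)
    both-cy (inj₂ (p , p')) _ = ⊥-elim (p' (Z-one _ _ p w₁-Boundary-Z))
    both-cy (inj₁ _) (inj₂ (q , q')) = ⊥-elim (q' (Z-one _ _ q w₁-Boundary-Z))

  Y-end⇒¬AB-end : PathCluster F Z → ∀ {c} → End F Z Y B c → ¬ End F Z AB X c
  Y-end⇒¬AB-end Z-path (inj₂ (none , _)) _ =
    none w₁ (w₁-Boundary-Z , (λ p → w₁∉B (proj₂ p)) , w₁-Boundary-Y)
  Y-end⇒¬AB-end Z-path {c} (inj₁ (_ , notBoth , c-Boundary-Y)) ab-end with Boundary-Y⁻ c c-Boundary-Y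
  ... | inj₂ refl = notBoth (proj₁ (End⇒Boundary {F} cz-end) , cz∈B)
  ... | inj₁ refl with ab-end
  ...   | inj₁ (_ , notBothAB , c-Boundary-AB) = notBothAB (proj₁ c-Boundary-AB , w₁∈X)
  ...   | inj₂ (none , _ , c∈AB , c∈X) with PathCluster-avoid {F} Z-path c
  ...     | o , o-Boundary-Z , o≢c = o-nowhere (TouchesZ⁻ (proj₁ o-Boundary-Z))
    where
    o∉AB : ¬ Touches AB o
    o∉AB o∈AB = none o (o-Boundary-Z ,
                        (λ { (ab , x) → o≢c (trans (≡cy x ab) (sym (≡cy c∈X c∈AB))) }) ,
                        Boundary-⊆ₑ {F} AB⊆Z o∈AB o-Boundary-Z)
    o-nowhere : Touches X o ⊎ Touches A o ⊎ Touches B o → ⊥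
    o-nowhere (inj₂ (inj₁ a)) = o∉AB (TouchesAB-A a)
    o-nowhere (inj₂ (inj₂ b)) = o∉AB (TouchesAB-B b)
    o-nowhere (inj₁ x) with Boundary-Y⁻ o (Boundary-⊆ₑ {F} Y⊆Z (Touches-⊆ₑ X⊆Y x) o-Boundary-Z)
    ... | inj₁ e = o≢c e
    ... | inj₂ e = o∉AB (TouchesAB-B (subst (Touches B) (sym e) cz∈B))

  B-end⇒¬X-end : PathCluster F Z → ∀ {c} → End F Z B Y c → ¬ End F Z X AB c
  B-end⇒¬X-end Z-path {c} b-end x-end with x-end
  ... | inj₁ (_ , notBothX , c-Boundary-X) =
    notBothX (proj₁ c-Boundary-X , TouchesAB-B (End⇒Touches {F} b-end))
  ... | inj₂ (noneX , _ , c∈X , c∈AB) with b-end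
  ...   | inj₁ (_ , notBothB , c-Boundary-B) = notBothB (proj₁ c-Boundary-B , Touches-⊆ₑ X⊆Y c∈X)
  ...   | inj₂ (noneB , _ , c∈B , c∈Y) with PathCluster-avoid {F} Z-path c
  ...     | o , o-Boundary-Z , o≢c = o-nowhere (TouchesZ⁻ (proj₁ o-Boundary-Z))
    where
    o∉X : ¬ Touches X o
    o∉X o∈X = noneX o (o-Boundary-Z ,
                       (λ { (x , ab) → o≢c (trans (≡cy x ab) (sym (≡cy c∈X c∈AB))) }) ,
                       Boundary-⊆ₑ {F} X⊆Z o∈X o-Boundary-Z)
    o∉B : ¬ Touches B o
    o∉B o∈B = noneB o (o-Boundary-Z , (λ { (b , y) → o≢c (shared-Y-B y b c∈Y c∈B) }) ,
                       Boundary-⊆ₑ {F} B⊆Z o∈B o-Boundary-Z)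
    o-nowhere : Touches X o ⊎ Touches A o ⊎ Touches B o → ⊥
    o-nowhere (inj₁ x) = o∉X x
    o-nowhere (inj₂ (inj₂ b)) = o∉B b
    o-nowhere (inj₂ (inj₁ a)) with Boundary-Y⁻ o (Boundary-⊆ₑ {F} Y⊆Z (Touches-⊆ₑ A⊆Y a) o-Boundary-Z)
    ... | inj₁ refl = o∉X w₁∈X
    ... | inj₂ refl = o∉B cz∈B

opp : Dir → Dir
opp L = R
opp R = L

Dir-cases : ∀ s d → s ≡ d ⊎ s ≡ opp d
Dir-cases L L = inj₁ refl
Dir-cases L R = inj₂ refl
Dir-cases R L = inj₂ refl
Dir-cases R R = inj₁ refl

opp-≡-⇔ : ∀ {s d s' d'} → (s ≡ d → ¬ s' ≡ opp d') → (s ≡ opp d → ¬ s' ≡ d')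
  → (opp d' ≡ s' ⇔ opp d ≡ s)
opp-≡-⇔ {s} {d} {s'} {d'} same opposite = mk⇔ to from
  where
  to : opp d' ≡ s' → opp d ≡ s
  to e with Dir-cases s d
  ... | inj₁ s≡d = ⊥-elim (same s≡d (sym e))
  ... | inj₂ s≡opp = sym s≡opp
  from : opp d ≡ s → opp d' ≡ s'
  from e with Dir-cases s' d'
  ... | inj₁ s'≡d' = ⊥-elim (opposite (sym e) s'≡d')
  ... | inj₂ s'≡opp = sym s'≡opp

mk-SameSet : ∀ d c o → SameSet (E (mk d c o)) (E c ++ E o)
mk-SameSet L c o = SameSet-refl
mk-SameSet R c o = ++-SameSet-comm {E o}

DisjointChildren : Tree → Set
DisjointChildren (leaf u v) = ⊤
DisjointChildren (node l r) = Disjointₑ (E l) (E r) × DisjointChildren l × DisjointChildren r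

DisjointChildren-mk : ∀ s u v → DisjointChildren (mk s u v)
  → Disjointₑ (E u) (E v) × DisjointChildren u × DisjointChildren v
DisjointChildren-mk L u v (d , du , dv) = d , du , dv
DisjointChildren-mk R u v (d , dv , du) = Disjointₑ-sym d , du , dv

AllNodes-mk : ∀ {P : Tree → Set} s u v → AllNodes P (mk s u v) → AllNodes P u × AllNodes P v
AllNodes-mk L u v (_ , pu , pv) = pu , pv
AllNodes-mk R u v (_ , pv , pu) = pu , pv

AllNodes-root : ∀ {P : Tree → Set} t → AllNodes P t → P t
AllNodes-root (leaf u v) p = p
AllNodes-root (node l r) p = proj₁ p

ValidNodes : Forest → Tree → Set
ValidNodes F = AllNodes (λ s → ValidCluster F (E s))

ValidNodes-Connected : ∀ {F} u → ValidNodes F u → Connected (E u)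
ValidNodes-Connected u valid = proj₂ (proj₁ (AllNodes-root u valid))

ValidNodes-AtMostTwo : ∀ {F} u → ValidNodes F u → AtMostTwoBoundary F (E u)
ValidNodes-AtMostTwo u valid = proj₂ (AllNodes-root u valid)

E-nonEmpty : ∀ t → NonEmpty (E t)
E-nonEmpty (leaf u v) = _ , here ≈e-refl
E-nonEmpty (node l r) with E-nonEmpty l
... | e , m = e , ⊆ₑ-++ˡ e m

AllPairs-++⁻ : ∀ {R : Edge → Edge → Set} xs {ys} → AllPairs R (xs ++ ys)
  → AllPairs R xs × AllPairs R ys × (∀ {x y} → x ∈ xs → y ∈ ys → R x y)
AllPairs-++⁻ [] ap = [] , ap , λ ()
AllPairs-++⁻ (x ∷ xs) (px ∷ ap) with AllPairs-++⁻ xs ap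
... | axs , ays , across = (Allₚ.++⁻ˡ xs px ∷ axs) , ays , across'
  where
  across' : ∀ {a b} → a ∈ (x ∷ xs) → b ∈ _ → _
  across' (here refl) m = All.lookup (Allₚ.++⁻ʳ xs px) m
  across' (there a) m = across a m

distinct⇒DisjointChildren : ∀ t → AllPairs (λ e e' → ¬ (e ≈e e')) (E t) → DisjointChildren t
distinct⇒DisjointChildren (leaf u v) _ = tt
distinct⇒DisjointChildren (node l r) ap with AllPairs-++⁻ (E l) ap
... | al , ar , across = l#r , distinct⇒DisjointChildren l al , distinct⇒DisjointChildren r ar
  where
  l#r : Disjointₑ (E l) (E r)
  l#r e a b with find a | find b
  ... | x , mx , px | y , my , py = across mx my (≈e-trans (≈e-sym px) py)

subtreeAt-++⁻ : ∀ t q r {u} → subtreeAt t (q ++ r) ≡ just u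
  → ∃ λ w → subtreeAt t q ≡ just w × subtreeAt w r ≡ just u
subtreeAt-++⁻ t [] r eq = t , refl , eq
subtreeAt-++⁻ (leaf _ _) (_ ∷ q) r ()
subtreeAt-++⁻ (node l _) (L ∷ q) r eq = subtreeAt-++⁻ l q r eq
subtreeAt-++⁻ (node _ rr) (R ∷ q) r eq = subtreeAt-++⁻ rr q r eq

subtreeAt-++⁺ : ∀ t q r {w u} → subtreeAt t q ≡ just w → subtreeAt w r ≡ just u
  → subtreeAt t (q ++ r) ≡ just u
subtreeAt-++⁺ t [] r refl eq = eq
subtreeAt-++⁺ (leaf _ _) (_ ∷ q) r () eq
subtreeAt-++⁺ (node l _) (L ∷ q) r eq₁ eq₂ = subtreeAt-++⁺ l q r eq₁ eq₂
subtreeAt-++⁺ (node _ rr) (R ∷ q) r eq₁ eq₂ = subtreeAt-++⁺ rr q r eq₁ eq₂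

subtreeAt-[_]⁻ : ∀ s {w u} → subtreeAt w [ s ] ≡ just u → ∃ λ v → w ≡ mk s u v
subtreeAt-[_]⁻ s {leaf _ _} ()
subtreeAt-[_]⁻ L {node l r} refl = r , refl
subtreeAt-[_]⁻ R {node l r} refl = l , refl

subtreeAt-mk-child : ∀ s u v → subtreeAt (mk s u v) [ s ] ≡ just u
subtreeAt-mk-child L u v = refl
subtreeAt-mk-child R u v = refl

subtreeAt-mk-sibling : ∀ s u v → subtreeAt (mk s u v) [ opp s ] ≡ just v
subtreeAt-mk-sibling L u v = refl
subtreeAt-mk-sibling R u v = refl

subtreeAt-⊆ₑ : ∀ t q {u} → subtreeAt t q ≡ just u → E u ⊆ₑ E t
subtreeAt-⊆ₑ t [] refl e m = m
subtreeAt-⊆ₑ (leaf _ _) (_ ∷ q) ()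
subtreeAt-⊆ₑ (node l r) (L ∷ q) eq e m = ⊆ₑ-++ˡ e (subtreeAt-⊆ₑ l q eq e m)
subtreeAt-⊆ₑ (node l r) (R ∷ q) eq e m = ⊆ₑ-++ʳ {E l} e (subtreeAt-⊆ₑ r q eq e m)

subtreeAt-AllNodes : ∀ {P : Tree → Set} t q {u} → AllNodes P t → subtreeAt t q ≡ just u → AllNodes P u
subtreeAt-AllNodes t [] all refl = all
subtreeAt-AllNodes (leaf _ _) (_ ∷ q) all ()
subtreeAt-AllNodes (node l r) (L ∷ q) all eq = subtreeAt-AllNodes l q (proj₁ (proj₂ all)) eq
subtreeAt-AllNodes (node l r) (R ∷ q) all eq = subtreeAt-AllNodes r q (proj₂ (proj₂ all)) eq

subtreeAt-DisjointChildren : ∀ t q {u} → DisjointChildren t → subtreeAt t q ≡ just u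
  → DisjointChildren u
subtreeAt-DisjointChildren t [] dc refl = dc
subtreeAt-DisjointChildren (leaf _ _) (_ ∷ q) dc ()
subtreeAt-DisjointChildren (node l r) (L ∷ q) dc eq = subtreeAt-DisjointChildren l q (proj₁ (proj₂ dc)) eq
subtreeAt-DisjointChildren (node l r) (R ∷ q) dc eq = subtreeAt-DisjointChildren r q (proj₂ (proj₂ dc)) eq

subtreeAt-OrientInv : ∀ {F} t q {u} → OrientInv F t → subtreeAt t q ≡ just u → OrientInv F u
subtreeAt-OrientInv t [] oi refl = oi
subtreeAt-OrientInv (leaf _ _) (_ ∷ q) oi ()
subtreeAt-OrientInv (node l r) (L ∷ q) oi eq = subtreeAt-OrientInv l q (proj₁ (proj₂ oi)) eq
subtreeAt-OrientInv (node l r) (R ∷ q) oi eq = subtreeAt-OrientInv r q (proj₂ (proj₂ oi)) eq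

position-unique : ∀ t q q' {u u'} → DisjointChildren t → subtreeAt t q ≡ just u
  → subtreeAt t q' ≡ just u' → SameSet (E u) (E u') → q ≡ q'
position-unique t [] [] dc eq eq' s = refl
position-unique (leaf _ _) _ (_ ∷ _) dc eq () s
position-unique (leaf _ _) (_ ∷ _) _ dc () eq' s
position-unique (node l r) [] (L ∷ q') (l#r , _) refl eq' s with E-nonEmpty r
... | e , m = ⊥-elim (l#r e (subtreeAt-⊆ₑ l q' eq' e (proj₁ (s e) (⊆ₑ-++ʳ {E l} e m))) m)
position-unique (node l r) [] (R ∷ q') (l#r , _) refl eq' s with E-nonEmpty l
... | e , m = ⊥-elim (l#r e m (subtreeAt-⊆ₑ r q' eq' e (proj₁ (s e) (⊆ₑ-++ˡ e m))))
position-unique (node l r) (L ∷ q) [] (l#r , _) eq refl s with E-nonEmpty r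
... | e , m = ⊥-elim (l#r e (subtreeAt-⊆ₑ l q eq e (proj₂ (s e) (⊆ₑ-++ʳ {E l} e m))) m)
position-unique (node l r) (R ∷ q) [] (l#r , _) eq refl s with E-nonEmpty l
... | e , m = ⊥-elim (l#r e m (subtreeAt-⊆ₑ r q eq e (proj₂ (s e) (⊆ₑ-++ˡ e m))))
position-unique (node l r) (L ∷ q) (L ∷ q') (_ , dl , _) eq eq' s = cong (L ∷_) (position-unique l q q' dl eq eq' s)
position-unique (node l r) (R ∷ q) (R ∷ q') (_ , _ , dr) eq eq' s = cong (R ∷_) (position-unique r q q' dr eq eq' s)
position-unique (node l r) (L ∷ q) (R ∷ q') {u} (l#r , _) eq eq' s with E-nonEmpty u
... | e , m = ⊥-elim (l#r e (subtreeAt-⊆ₑ l q eq e m) (subtreeAt-⊆ₑ r q' eq' e (proj₁ (s e) m)))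
position-unique (node l r) (R ∷ q) (L ∷ q') {u} (l#r , _) eq eq' s with E-nonEmpty u
... | e , m = ⊥-elim (l#r e (subtreeAt-⊆ₑ l q' eq' e (proj₁ (s e) m)) (subtreeAt-⊆ₑ r q eq e m))

SameSide-child⇔ : ∀ t q s sc {z c C D} → DisjointChildren t → subtreeAt t (q ++ [ s ]) ≡ just z
  → subtreeAt z [ sc ] ≡ just c → SameSet (E c) C → SameSet (E z) D
  → SameSide t C D ⇔ sc ≡ s
SameSide-child⇔ t q s sc {z} {c} dc at-z at-c c≈C z≈D = mk⇔ to from
  where
  at-c' : subtreeAt t ((q ++ [ s ]) ++ [ sc ]) ≡ just c
  at-c' = subtreeAt-++⁺ t (q ++ [ s ]) [ sc ] at-z at-c
  to : SameSide t _ _ → sc ≡ s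
  to (s' , (q₁ , u₁ , at₁ , u₁≈C) , (q₂ , u₂ , at₂ , u₂≈D)) =
    trans (sym (∷ʳ-injectiveʳ q₁ (q ++ [ s ])
                 (position-unique t (q₁ ++ [ s' ]) _ dc at₁ at-c' (SameSet-trans u₁≈C (SameSet-sym c≈C)))))
          (∷ʳ-injectiveʳ q₂ q
            (position-unique t (q₂ ++ [ s' ]) _ dc at₂ at-z (SameSet-trans u₂≈D (SameSet-sym z≈D))))
  from : sc ≡ s → SameSide t _ _
  from refl = s , (q ++ [ s ] , c , at-c' , c≈C) , (q , z , at-z , z≈D)

replace-subtreeAt : ∀ t q r s {w} → subtreeAt t q ≡ just w
  → subtreeAt (replace t (q ++ r) s) q ≡ just (replace w r s)
replace-subtreeAt t [] r s refl = refl
replace-subtreeAt (leaf _ _) (_ ∷ q) r s ()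
replace-subtreeAt (node l rr) (L ∷ q) r s eq = replace-subtreeAt l q r s eq
replace-subtreeAt (node l rr) (R ∷ q) r s eq = replace-subtreeAt rr q r s eq

replace-SameSet : ∀ t p {u} s → subtreeAt t p ≡ just u → SameSet (E s) (E u)
  → SameSet (E (replace t p s)) (E t)
replace-SameSet t [] s refl s≈u = s≈u
replace-SameSet (leaf _ _) (_ ∷ p) s () s≈u
replace-SameSet (node l r) (L ∷ p) s eq s≈u = ++-SameSet (replace-SameSet l p s eq s≈u) (SameSet-refl {E r})
replace-SameSet (node l r) (R ∷ p) s eq s≈u = ++-SameSet (SameSet-refl {E l}) (replace-SameSet r p s eq s≈u)

replace-DisjointChildren : ∀ t p {u} s → DisjointChildren t → subtreeAt t p ≡ just u
  → SameSet (E s) (E u) → DisjointChildren s → DisjointChildren (replace t p s)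
replace-DisjointChildren t [] s dc refl s≈u ds = ds
replace-DisjointChildren (leaf _ _) (_ ∷ p) s dc () s≈u ds
replace-DisjointChildren (node l r) (L ∷ p) s (l#r , dl , dr) eq s≈u ds =
  Disjointₑ-SameSet (SameSet-sym (replace-SameSet l p s eq s≈u)) SameSet-refl l#r ,
  replace-DisjointChildren l p s dl eq s≈u ds , dr
replace-DisjointChildren (node l r) (R ∷ p) s (l#r , dl , dr) eq s≈u ds =
  Disjointₑ-SameSet SameSet-refl (SameSet-sym (replace-SameSet r p s eq s≈u)) l#r ,
  dl , replace-DisjointChildren r p s dr eq s≈u ds

replace-mk-child : ∀ s u v w → replace (mk s u v) [ s ] w ≡ mk s w v
replace-mk-child L u v w = refl
replace-mk-child R u v w = refl

≅-SameSet : ∀ {t t'} → t ≅ t' → SameSet (E t) (E t')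
≅-SameSet leaf-same = SameSet-refl
≅-SameSet leaf-flip e = flip-edge , flip-edge
  where
  flip-edge : ∀ {u v} → e ∈ₑ ((u , v) ∷ []) → e ∈ₑ ((v , u) ∷ [])
  flip-edge (here q) = here (≈e-trans q ≈e-swap)
≅-SameSet (node-same l r) = ++-SameSet (≅-SameSet l) (≅-SameSet r)
≅-SameSet (node-swap {r' = r'} l r) = SameSet-trans (++-SameSet (≅-SameSet l) (≅-SameSet r)) (++-SameSet-comm {E r'})

≅-DisjointChildren : ∀ {t t'} → t ≅ t' → DisjointChildren t' → DisjointChildren t
≅-DisjointChildren leaf-same _ = tt
≅-DisjointChildren leaf-flip _ = tt
≅-DisjointChildren (node-same l r) (l#r , dl , dr) =
  Disjointₑ-SameSet (SameSet-sym (≅-SameSet l)) (SameSet-sym (≅-SameSet r)) l#r ,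
  ≅-DisjointChildren l dl , ≅-DisjointChildren r dr
≅-DisjointChildren (node-swap l r) (l#r , dl , dr) =
  Disjointₑ-SameSet (SameSet-sym (≅-SameSet l)) (SameSet-sym (≅-SameSet r)) (Disjointₑ-sym l#r) ,
  ≅-DisjointChildren l dr , ≅-DisjointChildren r dl

≅-subtreeAt : ∀ {t t'} → t ≅ t' → ∀ q {w} → subtreeAt t' q ≡ just w
  → ∃ λ q' → ∃ λ w' → subtreeAt t q' ≡ just w' × w' ≅ w
≅-subtreeAt iso [] refl = [] , _ , refl , iso
≅-subtreeAt leaf-same (_ ∷ q) ()
≅-subtreeAt leaf-flip (_ ∷ q) ()
≅-subtreeAt (node-same l r) (L ∷ q) eq with ≅-subtreeAt l q eq
... | q' , w' , eq' , iso = L ∷ q' , w' , eq' , iso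
≅-subtreeAt (node-same l r) (R ∷ q) eq with ≅-subtreeAt r q eq
... | q' , w' , eq' , iso = R ∷ q' , w' , eq' , iso
≅-subtreeAt (node-swap l r) (L ∷ q) eq with ≅-subtreeAt r q eq
... | q' , w' , eq' , iso = R ∷ q' , w' , eq' , iso
≅-subtreeAt (node-swap l r) (R ∷ q) eq with ≅-subtreeAt l q eq
... | q' , w' , eq' , iso = L ∷ q' , w' , eq' , iso

≅-mk : ∀ s u v {w} → w ≅ mk s u v
  → ∃ λ s' → ∃ λ u' → ∃ λ v' → w ≡ mk s' u' v' × u' ≅ u × v' ≅ v
≅-mk L u v (node-same l r) = L , _ , _ , refl , l , r
≅-mk L u v (node-swap l r) = R , _ , _ , refl , r , l
≅-mk R u v (node-same l r) = R , _ , _ , refl , r , l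
≅-mk R u v (node-swap l r) = L , _ , _ , refl , l , r

-- FacesSibling F s u c: c is the end of the s-child u that faces its sibling.
FacesSibling : Forest → Dir → Tree → Vertex → Set
FacesSibling F L u c = Rightmost F u c
FacesSibling F R u c = Leftmost F u c

OrientInv-central : ∀ {F} s u v → OrientInv F (mk s u v)
  → ∃ λ c → Touches (E u) c × Touches (E v) c × FacesSibling F s u c
OrientInv-central L u v ((c , (cu , cv) , rm , lm) , _) = c , cu , cv , rm
OrientInv-central R u v ((c , (cv , cu) , rm , lm) , _) = c , cu , cv , lm

FacesSibling-same : ∀ {F} d c o {w} → FacesSibling F d (mk d c o) w → End F (E (mk d c o)) (E o) (E c) w
FacesSibling-same {F} L c o f = Rightmost⇒End {F} {l = c} {r = o} f
FacesSibling-same {F} R c o f = Leftmost⇒End {F} {l = o} {r = c} f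

FacesSibling-opp : ∀ {F} d c o {w} → FacesSibling F (opp d) (mk d c o) w → End F (E (mk d c o)) (E c) (E o) w
FacesSibling-opp {F} L c o f = Leftmost⇒End {F} {l = c} {r = o} f
FacesSibling-opp {F} R c o f = Rightmost⇒End {F} {l = o} {r = c} f

≅-parent-of-node : ∀ {t T} → t ≅ T → ∀ q s {u v w} → subtreeAt T q ≡ just (mk s (node u v) w)
  → ∃ λ q' → ∃ λ s' → ∃ λ sc → ∃ λ u' → ∃ λ v' → ∃ λ w'
      → subtreeAt t q' ≡ just (mk s' (mk sc u' v') w') × u' ≅ u × v' ≅ v × w' ≅ w
≅-parent-of-node iso q s {u} {v} {w} at with ≅-subtreeAt iso q at
... | q' , _ , at' , iso-parent with ≅-mk s (node u v) w iso-parent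
...   | s' , _ , w' , refl , iso-uv , iso-w with ≅-mk L u v iso-uv
...     | sc , u' , v' , refl , iso-u , iso-v = q' , s' , sc , u' , v' , w' , at' , iso-u , iso-v , iso-w

subtreeAt-parent : ∀ t p {z} → p ≢ [] → subtreeAt t p ≡ just z
  → ∃ λ q → ∃ λ s → ∃ λ sib → p ≡ q ++ [ s ] × subtreeAt t q ≡ just (mk s z sib)
subtreeAt-parent t p p≢[] at with initLast p
... | [] = ⊥-elim (p≢[] refl)
... | q ∷ʳ′ s with subtreeAt-++⁻ t q [ s ] at
...   | w , at-parent , at-child with subtreeAt-[ s ]⁻ {w} at-child
...     | sib , refl = q , s , sib , refl , at-parent

module RotationSides (F : Forest) (t : Tree) (dc : DisjointChildren t) (t⊆F : E t ⊆ₑ edges F)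
  (valid : ValidNodes F t) (oi : OrientInv F t)
  (q : List Dir) (s₀ d : Dir) (x a b sib : Tree)
  (at-parent : subtreeAt t q ≡ just (mk s₀ (mk d (mk d x a) b) sib))
  (rotated-dc : DisjointChildren (node x (node a b)))
  where

  Y Z AB : List Edge
  Y = E (mk d x a)
  Z = E (mk d (mk d x a) b)
  AB = E a ++ E b

  rotated : Tree
  rotated = node x (node a b)

  at-z : subtreeAt t (q ++ [ s₀ ]) ≡ just (mk d (mk d x a) b)
  at-z = subtreeAt-++⁺ t q [ s₀ ] at-parent (subtreeAt-mk-child s₀ _ sib)

  at-sib : subtreeAt t (q ++ [ opp s₀ ]) ≡ just sib
  at-sib = subtreeAt-++⁺ t q [ opp s₀ ] at-parent (subtreeAt-mk-sibling s₀ _ sib)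

  rotated≈Z : SameSet (E rotated) Z
  rotated≈Z = SameSet-sym (SameSet-trans (mk-SameSet d (mk d x a) b)
                (SameSet-trans (++-SameSet (mk-SameSet d x a) (SameSet-refl {E b}))
                               (subst (SameSet ((E x ++ E a) ++ E b)) (++-assoc (E x) (E a) (E b)) SameSet-refl)))

  reoriented≈Z : ∀ sc {x' y'} → x' ≅ x → y' ≅ node a b → SameSet (E (mk sc x' y')) Z
  reoriented≈Z sc {x'} {y'} iso-x iso-y =
    SameSet-trans (SameSet-trans (mk-SameSet sc x' y') (++-SameSet (≅-SameSet iso-x) (≅-SameSet iso-y))) rotated≈Z

  at-parent-rotated : subtreeAt (replace t (q ++ [ s₀ ]) rotated) q ≡ just (mk s₀ rotated sib)
  at-parent-rotated = subst (λ u → subtreeAt (replace t (q ++ [ s₀ ]) rotated) q ≡ just u)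
                            (replace-mk-child s₀ (mk d (mk d x a) b) sib rotated)
                            (replace-subtreeAt t q [ s₀ ] rotated at-parent)

  rotated-tree-dc : DisjointChildren (replace t (q ++ [ s₀ ]) rotated)
  rotated-tree-dc = replace-DisjointChildren t (q ++ [ s₀ ]) rotated dc at-z rotated≈Z rotated-dc

  side-before : SameSide t (E b) Z ⇔ opp d ≡ s₀
  side-before = SameSide-child⇔ t q s₀ (opp d) dc at-z (subtreeAt-mk-sibling d (mk d x a) b)
                  SameSet-refl SameSet-refl

  shared-Z-sib : ∀ {u v} → Touches Z u → Touches (E sib) u → Touches Z v → Touches (E sib) v → u ≡ v
  shared-Z-sib = shared-vertex-unique F
    (ValidNodes-Connected {F} (mk d (mk d x a) b) (proj₁ valid-children))
    (ValidNodes-Connected {F} sib (proj₂ valid-children))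
    (⊆ₑ-trans (subtreeAt-⊆ₑ t (q ++ [ s₀ ]) at-z) t⊆F)
    (⊆ₑ-trans (subtreeAt-⊆ₑ t (q ++ [ opp s₀ ]) at-sib) t⊆F)
    (proj₁ (DisjointChildren-mk s₀ (mk d (mk d x a) b) sib (subtreeAt-DisjointChildren t q dc at-parent)))
    where
    valid-children : ValidNodes F (mk d (mk d x a) b)
                   × ValidNodes F sib
    valid-children = AllNodes-mk s₀ (mk d (mk d x a) b) sib (subtreeAt-AllNodes t q valid at-parent)

  same-side-⇔ : (∀ {c} → End F Z Y (E b) c → ¬ End F Z AB (E x) c)
    → (∀ {c} → End F Z (E b) Y c → ¬ End F Z (E x) AB c)
    → ∀ t' → t' ≅ replace t (q ++ [ s₀ ]) rotated → OrientInv F t'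
    → SameSide t' AB Z ⇔ SameSide t (E b) Z
  same-side-⇔ Y-end⇒¬AB-end B-end⇒¬X-end t' iso oi'
    with OrientInv-central s₀ (mk d (mk d x a) b) sib (subtreeAt-OrientInv t q oi at-parent)
       | ≅-parent-of-node iso q s₀ at-parent-rotated
  ... | c , c∈Z , c∈sib , faces | q' , s₀' , sx , x' , y' , sib' , at-parent' , iso-x , iso-y , iso-sib
    with OrientInv-central s₀' (mk sx x' y') sib' (subtreeAt-OrientInv t' q' oi' at-parent')
  ...   | c' , c'∈Z' , c'∈sib' , faces'
    with shared-Z-sib (Touches-⊆ₑ (SameSet⇒⊆ₑ (reoriented≈Z sx iso-x iso-y)) c'∈Z')
                      (Touches-⊆ₑ (SameSet⇒⊆ₑ (≅-SameSet iso-sib)) c'∈sib') c∈Z c∈sib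
  ...     | refl = ⇔.trans side-after (⇔.trans sides-agree (⇔.sym side-before))
    where
    at-z' : subtreeAt t' (q' ++ [ s₀' ]) ≡ just (mk sx x' y')
    at-z' = subtreeAt-++⁺ t' q' [ s₀' ] at-parent' (subtreeAt-mk-child s₀' (mk sx x' y') sib')
    AB-end : FacesSibling F sx (mk sx x' y') c' → End F Z AB (E x) c'
    AB-end f = End-SameSet {F} (reoriented≈Z sx iso-x iso-y) (≅-SameSet iso-y) (≅-SameSet iso-x)
                 (FacesSibling-same sx x' y' f)
    X-end : FacesSibling F (opp sx) (mk sx x' y') c' → End F Z (E x) AB c'
    X-end f = End-SameSet {F} (reoriented≈Z sx iso-x iso-y) (≅-SameSet iso-x) (≅-SameSet iso-y)
                (FacesSibling-opp sx x' y' f)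
    side-after : SameSide t' AB Z ⇔ opp sx ≡ s₀'
    side-after = SameSide-child⇔ t' q' s₀' (opp sx) (≅-DisjointChildren iso rotated-tree-dc) at-z'
                   (subtreeAt-mk-sibling sx x' y') (≅-SameSet iso-y) (reoriented≈Z sx iso-x iso-y)
    sides-agree : opp sx ≡ s₀' ⇔ opp d ≡ s₀
    sides-agree = opp-≡-⇔
      (λ { refl refl → B-end⇒¬X-end (FacesSibling-same d (mk d x a) b faces) (X-end faces') })
      (λ { refl refl → Y-end⇒¬AB-end (FacesSibling-opp d (mk d x a) b faces) (AB-end faces') })

module Rotation (F : Forest) (t : Tree) (top : TopTree F t) (oi : OrientInv F t)
  (p : List Dir) (d : Dir) (x a b : Tree)
  (at-z : subtreeAt t p ≡ just (mk d (mk d x a) b)) (y-path : PathCluster F (E (mk d x a)))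
  where

  y z : Tree
  y = mk d x a
  z = mk d y b

  dc : DisjointChildren t
  dc = distinct⇒DisjointChildren t (proj₁ top)

  t⊆F : E t ⊆ₑ edges F
  t⊆F = All⇒⊆ₑ (proj₁ (proj₂ top))

  valid : ValidNodes F t
  valid = proj₂ (proj₂ (proj₂ top))

  valid-y×b : ValidNodes F y × ValidNodes F b
  valid-y×b = AllNodes-mk d y b (subtreeAt-AllNodes t p valid at-z)

  valid-x×a : ValidNodes F x × ValidNodes F a
  valid-x×a = AllNodes-mk d x a (proj₁ valid-y×b)

  dc-y×b : Disjointₑ (E y) (E b) × DisjointChildren y × DisjointChildren b
  dc-y×b = DisjointChildren-mk d y b (subtreeAt-DisjointChildren t p dc at-z)

  dc-x×a : Disjointₑ (E x) (E a) × DisjointChildren x × DisjointChildren a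
  dc-x×a = DisjointChildren-mk d x a (proj₁ (proj₂ dc-y×b))

  x#b : Disjointₑ (E x) (E b)
  x#b e e∈x = proj₁ dc-y×b e (proj₂ (mk-SameSet d x a e) (⊆ₑ-++ˡ e e∈x))

  a#b : Disjointₑ (E a) (E b)
  a#b e e∈a = proj₁ dc-y×b e (proj₂ (mk-SameSet d x a e) (⊆ₑ-++ʳ {E x} e e∈a))

  oi-z : OrientInv F z
  oi-z = subtreeAt-OrientInv t p oi at-z

  central-y : ∃ λ c → Touches (E x) c × Touches (E a) c × FacesSibling F d x c
  central-y = OrientInv-central d x a (subtreeAt-OrientInv z [ d ] oi-z (subtreeAt-mk-child d y b))

  central-z : ∃ λ c → Touches (E y) c × Touches (E b) c × FacesSibling F d y c
  central-z = OrientInv-central d y b oi-z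

  open RotationClusters F (E x) (E a) (E b) (E y) (E z) (mk-SameSet d x a) (mk-SameSet d y b)
    (ValidNodes-Connected {F} x (proj₁ valid-x×a)) (ValidNodes-Connected {F} a (proj₂ valid-x×a))
    (ValidNodes-Connected {F} b (proj₂ valid-y×b)) (ValidNodes-Connected {F} y (proj₁ valid-y×b))
    (⊆ₑ-trans (subtreeAt-⊆ₑ t p at-z) t⊆F) (proj₁ dc-x×a) x#b a#b
    y-path (ValidNodes-AtMostTwo {F} a (proj₂ valid-x×a)) (ValidNodes-AtMostTwo {F} z (subtreeAt-AllNodes t p valid at-z))
    (proj₁ central-y) (proj₁ (proj₂ central-y)) (proj₁ (proj₂ (proj₂ central-y)))
    (proj₁ central-z) (proj₁ (proj₂ (proj₂ central-z)))
    (FacesSibling-same d x a (proj₂ (proj₂ (proj₂ central-z))))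
    public

  rotated-dc : DisjointChildren (node x (node a b))
  rotated-dc = X#AB , proj₁ (proj₂ dc-x×a) , a#b , proj₂ (proj₂ dc-x×a) , proj₂ (proj₂ dc-y×b)

  same-side : p ≢ [] → PathCluster F (E z) → ∀ t' → t' ≅ replace t p (node x (node a b)) → OrientInv F t'
    → SameSide t' AB (E z) ⇔ SameSide t (E b) (E z)
  same-side p≢[] z-path t' iso oi' with subtreeAt-parent t p p≢[] at-z
  ... | q , s₀ , sib , p≡q∷ʳs₀ , at-parent =
    RotationSides.same-side-⇔ F t dc t⊆F valid oi q s₀ d x a b sib at-parent rotated-dc
      (Y-end⇒¬AB-end z-path) (B-end⇒¬X-end z-path)
      t' (subst (λ p → t' ≅ replace t p (node x (node a b))) p≡q∷ʳs₀ iso) oi'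

lemma4p5 : (F : Forest) (t : Tree) → TopTree F t → OrientInv F t
    → (p : List Dir) (d : Dir) (x a b : Tree)
    → subtreeAt t p ≡ just (mk d (mk d x a) b)
    → PathCluster F (E (mk d x a))
    → ValidCluster F (E a ++ E b)
      × (∀ t' → t' ≅ replace t p (node x (node a b)) → OrientInv F t'
          → (p ≢ [] → PathCluster F (E (mk d (mk d x a) b))
              → SameSide t' (E a ++ E b) (E (mk d (mk d x a) b))
                ⇔ SameSide t (E b) (E (mk d (mk d x a) b)))
            × (PointCluster F (E (mk d (mk d x a) b)) → PointCluster F (E a ++ E b)))
lemma4p5 F t top oi p d x a b at-z y-path =
  AB-valid , λ t' iso oi' → (λ p≢[] z-path → same-side p≢[] z-path t' iso oi') , AB-point
  where open Rotation F t top oi p d x a b at-z y-path
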